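{- For all structures $\Gamma$ (finite multiset of labelled formulae and relational atoms), $\Delta$ (finite multiset of labelled formulae) and every relational atom $(x,y\triangleright z)$: if $\Pi$ is a cut-free $LS_{BBI}$ derivation of $(x,y\triangleright z);(x,y\triangleright z);\Gamma\vdash\Delta$, then there is a cut-free $LS_{BBI}$ derivation $\Pi'$ of $(x,y\triangleright z);\Gamma\vdash\Delta$ with $ht(\Pi')\le ht(\Pi)$.
   Context: BBI formulae: $A ::= p \mid \top \mid \bot \mid \neg A \mid A\lor A \mid A\land A \mid A\to A \mid \top^* \mid A * A \mid A \mathrel{ -\!*} A$, $p$ atomic; $\neg A$ abbreviates $A\to\bot$ and $A\lor B$ abbreviates $\neg(\neg A\land\neg B)$. Labels are label variables (from an infinite set $LVar$) or the constant $\epsilon$. A labelled formula is $w:A$; a relational atom is $(x,y\triangleright z)$ for labels $x,y,z$. A sequent $\Gamma\vdash\Delta$ has $\Gamma$ a finite multiset of labelled formulae and relational atoms and $\Delta$ a finite multiset of labelled formulae; ";" is multiset union. $\Gamma[y/x]$ replaces every occurrence of label $x$ by $y$. The height $ht(\Pi)$ of a derivation is the length of a longest branch in its derivation tree. Rules of $LS_{BBI}$ ("from premises infer conclusion"; $P$ atomic): id: infer $\Gamma;w:P\vdash w:P;\Delta$. $\bot L$: infer $\Gamma;w:\bot\vdash\Delta$. $\top R$: infer $\Gamma\vdash w:\top;\Delta$. $\top^*R$: infer $\Gamma\vdash\epsilon:\top^*;\Delta$. cut: from $\Gamma\vdash x:A;\Delta$ and $\Gamma';x:A\vdash\Delta'$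 infer $\Gamma;\Gamma'\vdash\Delta;\Delta'$. $\top^*L$: from $\Gamma[\epsilon/w]\vdash\Delta[\epsilon/w]$ infer $\Gamma;w:\top^*\vdash\Delta$ ($w\neq\epsilon$). $\land L$: from $\Gamma;w:A;w:B\vdash\Delta$ infer $\Gamma;w:A\land B\vdash\Delta$. $\land R$: from $\Gamma\vdash w:A;\Delta$ and $\Gamma\vdash w:B;\Delta$ infer $\Gamma\vdash w:A\land B;\Delta$. $\to L$: from $\Gamma\vdash w:A;\Delta$ and $\Gamma;w:B\vdash\Delta$ infer $\Gamma;w:A\to B\vdash\Delta$. $\to R$: from $\Gamma;w:A\vdash w:B;\Delta$ infer $\Gamma\vdash w:A\to B;\Delta$. $*L$: from $(x,y\triangleright z);\Gamma;x:A;y:B\vdash\Delta$ infer $\Gamma;z:A*B\vdash\Delta$ ($x,y$ not in the conclusion). $\mathrel{ -\!*}R$: from $(x,y\triangleright z);\Gamma;x:A\vdash z:B;\Delta$ infer $\Gamma\vdash y:A\mathrel{ -\!*}B;\Delta$ ($x,z$ not in the conclusion). $*R$: from $(x,y\triangleright z);\Gamma\vdash x:A;z:A*B;\Delta$ and $(x,y\triangleright z);\Gamma\vdash y:B;z:A*B;\Delta$ infer $(x,y\triangleright z);\Gamma\vdash z:A*B;\Delta$. $\mathrel{ -\!*}L$: from $(x,y\triangleright z);\Gamma;y:A\mathrel{ -\!*}B\vdash x:A;\Delta$ and $(x,y\triangleright z);\Gamma;y:A\mathrel{ -\!*}B;z:B\vdash\Delta$ infer $(x,y\triangleright z);\Gamma;y:A\mathrel{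 -\!*}B\vdash\Delta$. E: from $(y,x\triangleright z);(x,y\triangleright z);\Gamma\vdash\Delta$ infer $(x,y\triangleright z);\Gamma\vdash\Delta$. U: from $(x,\epsilon\triangleright x);\Gamma\vdash\Delta$ infer $\Gamma\vdash\Delta$. A: from $(u,w\triangleright z);(y,v\triangleright w);(x,y\triangleright z);(u,v\triangleright x);\Gamma\vdash\Delta$ infer $(x,y\triangleright z);(u,v\triangleright x);\Gamma\vdash\Delta$ ($w$ not in the conclusion). $A_C$: from $(x,w\triangleright x);(y,y\triangleright w);(x,y\triangleright x);\Gamma\vdash\Delta$ infer $(x,y\triangleright x);\Gamma\vdash\Delta$ ($w$ not in the conclusion). $Eq_1$: from $(\epsilon,w'\triangleright w');\Gamma[w'/w]\vdash\Delta[w'/w]$ infer $(\epsilon,w\triangleright w');\Gamma\vdash\Delta$ ($w\neq\epsilon$). $Eq_2$: from $(\epsilon,w'\triangleright w');\Gamma[w'/w]\vdash\Delta[w'/w]$ infer $(\epsilon,w'\triangleright w);\Gamma\vdash\Delta$ ($w\neq\epsilon$). -}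

module Defs where

open import Data.Nat using (ℕ; suc; _⊔_; _≟_)
open import Data.Product using (_×_; _,_; Σ)
open import Data.Sum using (_⊎_)
open import Data.List using (List; []; _∷_; _++_; map)
open import Data.List.Relation.Unary.Any using (Any)
open import Data.List.Relation.Binary.Permutation.Propositional using (_↭_)
open import Data.Empty using (⊥)
open import Data.Unit using (⊤)
open import Relation.Nullary using (¬_; Dec; yes; no)
open import Relation.Binary.PropositionalEquality using (_≡_; _≢_; refl; cong)

data Fml : Set where
  atom  : ℕ → Fml
  ⊤ᶠ    : Fml
  ⊥ᶠ    : Fml
  _∧ᶠ_  : Fml → Fml → Fml
  _⇒ᶠ_  : Fml → Fml → Fml
  ⊤*    : Fml
  _✱_   : Fml → Fml → Fml
  _−✱_  : Fml → Fml → Fml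

¬ᶠ_ : Fml → Fml
¬ᶠ A = A ⇒ᶠ ⊥ᶠ

_∨ᶠ_ : Fml → Fml → Fml
A ∨ᶠ B = ¬ᶠ ((¬ᶠ A) ∧ᶠ (¬ᶠ B))

data Label : Set where
  var : ℕ → Label
  ε   : Label

IsVar : Label → Set
IsVar (var _) = ⊤
IsVar ε       = ⊥

_≟L_ : (a b : Label) → Dec (a ≡ b)
var m ≟L var n with m ≟ n
... | yes refl = yes refl
... | no  m≢n  = no (λ { refl → m≢n refl })
var m ≟L ε     = no (λ ())
ε     ≟L var n = no (λ ())
ε     ≟L ε     = yes refl

LF : Set
LF = Label × Fml

data Item : Set where
  lf  : Label → Fml → Item
  rel : Label → Label → Label → Item     -- rel x y z  =  (x , y ▷ z)

record Seq : Set where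
  constructor _⊢_
  field
    ant : List Item
    succ : List LF
infix 4 _⊢_

-- Sequents are pairs of finite multisets: equality up to permutation.
_≈_ : Seq → Seq → Set
(Γ ⊢ Δ) ≈ (Γ' ⊢ Δ') = (Γ ↭ Γ') × (Δ ↭ Δ')
infix 3 _≈_

sL : Label → Label → Label → Label
sL y x l with l ≟L x
... | yes _ = y
... | no  _ = l

sItem : Label → Label → Item → Item
sItem y x (lf w A)    = lf (sL y x w) A
sItem y x (rel a b c) = rel (sL y x a) (sL y x b) (sL y x c)

sLF : Label → Label → LF → LF
sLF y x (w , A) = (sL y x w , A)

_[_/_]ᴳ : List Item → Label → Label → List Item
Γ [ y / x ]ᴳ = map (sItem y x) Γ

_[_/_]ᴰ : List LF → Label → Label → List LF
Δ [ y / x ]ᴰ = map (sLF y x) Δ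

OccI : Label → Item → Set
OccI l (lf w _)    = l ≡ w
OccI l (rel a b c) = l ≡ a ⊎ l ≡ b ⊎ l ≡ c

OccD : Label → LF → Set
OccD l (w , _) = l ≡ w

Fresh : Label → Seq → Set
Fresh l (Γ ⊢ Δ) = IsVar l × ¬ Any (OccI l) Γ × ¬ Any (OccD l) Δ

-- Derivations in LS_BBI (including cut).  Each rule derives any sequent
-- that is multiset-equal (≈) to its displayed conclusion.

data Deriv : Seq → Set where
  id   : ∀ {s Γ Δ w P} → s ≈ (lf w (atom P) ∷ Γ ⊢ (w , atom P) ∷ Δ) → Deriv s
  ⊥L   : ∀ {s Γ Δ w} → s ≈ (lf w ⊥ᶠ ∷ Γ ⊢ Δ) → Deriv s
  ⊤R   : ∀ {s Γ Δ w} → s ≈ (Γ ⊢ (w , ⊤ᶠ) ∷ Δ) → Deriv s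
  ⊤*R  : ∀ {s Γ Δ} → s ≈ (Γ ⊢ (ε , ⊤*) ∷ Δ) → Deriv s
  cut  : ∀ {s Γ Γ' Δ Δ' x A} → s ≈ (Γ ++ Γ' ⊢ Δ ++ Δ') →
         Deriv (Γ ⊢ (x , A) ∷ Δ) → Deriv (lf x A ∷ Γ' ⊢ Δ') → Deriv s
  ⊤*L  : ∀ {s Γ Δ w} → w ≢ ε → s ≈ (lf w ⊤* ∷ Γ ⊢ Δ) →
         Deriv (Γ [ ε / w ]ᴳ ⊢ Δ [ ε / w ]ᴰ) → Deriv s
  ∧L   : ∀ {s Γ Δ w A B} → s ≈ (lf w (A ∧ᶠ B) ∷ Γ ⊢ Δ) →
         Deriv (lf w A ∷ lf w B ∷ Γ ⊢ Δ) → Deriv s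
  ∧R   : ∀ {s Γ Δ w A B} → s ≈ (Γ ⊢ (w , A ∧ᶠ B) ∷ Δ) →
         Deriv (Γ ⊢ (w , A) ∷ Δ) → Deriv (Γ ⊢ (w , B) ∷ Δ) → Deriv s
  ⇒L   : ∀ {s Γ Δ w A B} → s ≈ (lf w (A ⇒ᶠ B) ∷ Γ ⊢ Δ) →
         Deriv (Γ ⊢ (w , A) ∷ Δ) → Deriv (lf w B ∷ Γ ⊢ Δ) → Deriv s
  ⇒R   : ∀ {s Γ Δ w A B} → s ≈ (Γ ⊢ (w , A ⇒ᶠ B) ∷ Δ) →
         Deriv (lf w A ∷ Γ ⊢ (w , B) ∷ Δ) → Deriv s
  ✱L   : ∀ {s Γ Δ x y z A B} → s ≈ (lf z (A ✱ B) ∷ Γ ⊢ Δ) →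
         x ≢ y → Fresh x (lf z (A ✱ B) ∷ Γ ⊢ Δ) → Fresh y (lf z (A ✱ B) ∷ Γ ⊢ Δ) →
         Deriv (rel x y z ∷ lf x A ∷ lf y B ∷ Γ ⊢ Δ) → Deriv s
  −✱R  : ∀ {s Γ Δ x y z A B} → s ≈ (Γ ⊢ (y , A −✱ B) ∷ Δ) →
         x ≢ z → Fresh x (Γ ⊢ (y , A −✱ B) ∷ Δ) → Fresh z (Γ ⊢ (y , A −✱ B) ∷ Δ) →
         Deriv (rel x y z ∷ lf x A ∷ Γ ⊢ (z , B) ∷ Δ) → Deriv s
  ✱R   : ∀ {s Γ Δ x y z A B} → s ≈ (rel x y z ∷ Γ ⊢ (z , A ✱ B) ∷ Δ) →
         Deriv (rel x y z ∷ Γ ⊢ (x , A) ∷ (z , A ✱ B) ∷ Δ) →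
         Deriv (rel x y z ∷ Γ ⊢ (y , B) ∷ (z , A ✱ B) ∷ Δ) → Deriv s
  −✱L  : ∀ {s Γ Δ x y z A B} → s ≈ (rel x y z ∷ lf y (A −✱ B) ∷ Γ ⊢ Δ) →
         Deriv (rel x y z ∷ lf y (A −✱ B) ∷ Γ ⊢ (x , A) ∷ Δ) →
         Deriv (rel x y z ∷ lf y (A −✱ B) ∷ lf z B ∷ Γ ⊢ Δ) → Deriv s
  E    : ∀ {s Γ Δ x y z} → s ≈ (rel x y z ∷ Γ ⊢ Δ) →
         Deriv (rel y x z ∷ rel x y z ∷ Γ ⊢ Δ) → Deriv s
  U    : ∀ {s Γ Δ x} → s ≈ (Γ ⊢ Δ) →
         Deriv (rel x ε x ∷ Γ ⊢ Δ) → Deriv s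
  A    : ∀ {s Γ Δ x y z u v w} → s ≈ (rel x y z ∷ rel u v x ∷ Γ ⊢ Δ) →
         Fresh w (rel x y z ∷ rel u v x ∷ Γ ⊢ Δ) →
         Deriv (rel u w z ∷ rel y v w ∷ rel x y z ∷ rel u v x ∷ Γ ⊢ Δ) → Deriv s
  AC   : ∀ {s Γ Δ x y w} → s ≈ (rel x y x ∷ Γ ⊢ Δ) →
         Fresh w (rel x y x ∷ Γ ⊢ Δ) →
         Deriv (rel x w x ∷ rel y y w ∷ rel x y x ∷ Γ ⊢ Δ) → Deriv s
  Eq₁  : ∀ {s Γ Δ w w'} → w ≢ ε → s ≈ (rel ε w w' ∷ Γ ⊢ Δ) →
         Deriv (rel ε w' w' ∷ Γ [ w' / w ]ᴳ ⊢ Δ [ w' / w ]ᴰ) → Deriv s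
  Eq₂  : ∀ {s Γ Δ w w'} → w ≢ ε → s ≈ (rel ε w' w ∷ Γ ⊢ Δ) →
         Deriv (rel ε w' w' ∷ Γ [ w' / w ]ᴳ ⊢ Δ [ w' / w ]ᴰ) → Deriv s

height : ∀ {s} → Deriv s → ℕ
height (id _)          = 1
height (⊥L _)          = 1
height (⊤R _)          = 1
height (⊤*R _)         = 1
height (cut _ p q)     = suc (height p ⊔ height q)
height (⊤*L _ _ p)     = suc (height p)
height (∧L _ p)        = suc (height p)
height (∧R _ p q)      = suc (height p ⊔ height q)
height (⇒L _ p q)      = suc (height p ⊔ height q)
height (⇒R _ p)        = suc (height p)
height (✱L _ _ _ _ p)  = suc (height p)
height (−✱R _ _ _ _ p) = suc (height p)
height (✱R _ p q)      = suc (height p ⊔ height q)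
height (−✱L _ p q)     = suc (height p ⊔ height q)
height (E _ p)         = suc (height p)
height (U _ p)         = suc (height p)
height (A _ _ p)       = suc (height p)
height (AC _ _ p)      = suc (height p)
height (Eq₁ _ _ p)     = suc (height p)
height (Eq₂ _ _ p)     = suc (height p)

CutFree : ∀ {s} → Deriv s → Set
CutFree (id _)          = ⊤
CutFree (⊥L _)          = ⊤
CutFree (⊤R _)          = ⊤
CutFree (⊤*R _)         = ⊤
CutFree (cut _ _ _)     = ⊥
CutFree (⊤*L _ _ p)     = CutFree p
CutFree (∧L _ p)        = CutFree p
CutFree (∧R _ p q)      = CutFree p × CutFree q
CutFree (⇒L _ p q)      = CutFree p × CutFree q
CutFree (⇒R _ p)        = CutFree p
CutFree (✱L _ _ _ _ p)  = CutFree p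
CutFree (−✱R _ _ _ _ p) = CutFree p
CutFree (✱R _ p q)      = CutFree p × CutFree q
CutFree (−✱L _ p q)     = CutFree p × CutFree q
CutFree (E _ p)         = CutFree p
CutFree (U _ p)         = CutFree p
CutFree (A _ _ p)       = CutFree p
CutFree (AC _ _ p)      = CutFree p
CutFree (Eq₁ _ _ p)     = CutFree p
CutFree (Eq₂ _ _ p)     = CutFree p

-- If the duplicated atom is not principal, the
-- last rule is re-applied with one copy dropped from its context. A rule that
-- is principal on a relational atom (✱R, −✱L, E, A, AC) keeps that atom in its
-- premises, so the remaining copy serves both. Under Eq₁/Eq₂ both copies of the
-- principal atom become (ε,w'▷w'), which is contracted in the premise. The one
-- genuinely new case is A applied to two copies of the same atom (x,y▷x): its
-- premise is then exactly a premise of AC, and AC replaces it.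
module Submission where

open import Defs
open import Data.Nat using (ℕ; _≤_; z≤n; s≤s)
open import Data.Nat.Properties using (⊔-mono-≤)
open import Data.Product using (Σ; ∃-syntax; _×_; _,_)
open import Data.Sum using (_⊎_; inj₁; inj₂)
open import Data.List using (List; []; _∷_; _++_; [_]; map)
open import Data.List.Relation.Unary.Any using (here; there)
open import Data.List.Membership.Propositional using (_∈_)
open import Data.List.Membership.Propositional.Properties using (∈-∃++)
open import Data.List.Relation.Binary.Subset.Propositional using (_⊆_)
open import Data.List.Relation.Binary.Subset.Propositional.Properties
  using (⊆-trans; ⊆-reflexive-↭; xs⊆x∷xs; Any-resp-⊆)
open import Data.List.Relation.Binary.Permutation.Propositional
  using (_↭_; ↭-refl; ↭-sym; ↭-trans; prep)
open import Data.List.Relation.Binary.Permutation.Propositional.Properties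
  using (∈-resp-↭; ++⁺ˡ; shift; drop-∷; map⁺)
open import Data.Empty using (⊥-elim)
open import Function using (_∘_)
open import Relation.Nullary using (yes; no)
open import Relation.Binary.PropositionalEquality using (_≡_; _≢_; refl; sym)

Contraction : ∀ {a} {A : Set a} → A → List A → List A → Set a
Contraction r xs ys = ∃[ zs ] (xs ↭ r ∷ r ∷ zs × ys ↭ r ∷ zs)

module _ {a} {A : Set a} where

  private variable
    x x' r : A
    xs xs' ys ys' : List A

  ∈⇒↭∷ : x ∈ xs → ∃[ zs ] xs ↭ x ∷ zs
  ∈⇒↭∷ x∈xs with ys , zs , refl ← ∈-∃++ x∈xs = ys ++ zs , shift _ ys zs

  shift-↭ : ∀ ws → xs ↭ r ∷ ys → ws ++ xs ↭ r ∷ ws ++ ys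
  shift-↭ {r = r} {ys = ys} ws p = ↭-trans (++⁺ˡ ws p) (shift r ws ys)

  shift²-↭ : ∀ ws → xs ↭ r ∷ r ∷ ys → ws ++ xs ↭ r ∷ r ∷ ws ++ ys
  shift²-↭ {r = r} {ys = ys} ws p = ↭-trans (shift-↭ ws p) (prep r (shift r ws ys))

  ∈-∷∷⇒∈-∷ : x ∈ r ∷ r ∷ ys → x ∈ r ∷ ys
  ∈-∷∷⇒∈-∷ (here x≡r) = here x≡r
  ∈-∷∷⇒∈-∷ (there x∈) = x∈

  ∷↭∷∷-inv : x ∷ xs ↭ r ∷ r ∷ ys →
             (x ≡ r × xs ↭ r ∷ ys) ⊎ ∃[ zs ] (xs ↭ r ∷ r ∷ zs × ys ↭ x ∷ zs)
  ∷↭∷∷-inv p with ∈-resp-↭ p (here refl)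
  ... | here refl         = inj₁ (refl , drop-∷ p)
  ... | there (here refl) = inj₁ (refl , drop-∷ p)
  ... | there (there x∈ys) with zs , ys↭ ← ∈⇒↭∷ x∈ys =
    inj₂ (zs , drop-∷ (↭-trans p (shift-↭ (_ ∷ _ ∷ []) ys↭)) , ys↭)

  ∷↭∷∷⇒∷↭∷ : x ∷ xs ↭ r ∷ r ∷ ys → ∃[ zs ] r ∷ ys ↭ x ∷ zs
  ∷↭∷∷⇒∷↭∷ p = ∈⇒↭∷ (∈-∷∷⇒∈-∷ (∈-resp-↭ p (here refl)))

  ∷∷↭∷∷-inv : x ∷ x' ∷ xs ↭ r ∷ r ∷ ys →
              (x ≡ r × x' ≡ r) ⊎ ∃[ zs ] r ∷ ys ↭ x ∷ x' ∷ zs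
  ∷∷↭∷∷-inv p with ∷↭∷∷-inv p
  ... | inj₂ (_ , x'xs↭ , ys↭) with zs , ↭x'zs ← ∷↭∷∷⇒∷↭∷ x'xs↭ =
    inj₂ (zs , ↭-trans (shift-↭ [ _ ] ys↭) (prep _ ↭x'zs))
  ... | inj₁ (refl , x'xs↭) with ∈-resp-↭ x'xs↭ (here refl)
  ...   | here refl = inj₁ (refl , refl)
  ...   | there x'∈ys with zs , ys↭ ← ∈⇒↭∷ x'∈ys = inj₂ (zs , prep _ ys↭)

  contraction-respˡ : xs ↭ xs' → Contraction r xs ys → Contraction r xs' ys
  contraction-respˡ p (zs , xs↭ , ys↭) = zs , ↭-trans (↭-sym p) xs↭ , ys↭

  contraction-respʳ : ys ↭ ys' → Contraction r xs ys → Contraction r xs ys'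
  contraction-respʳ p (zs , xs↭ , ys↭) = zs , xs↭ , ↭-trans (↭-sym p) ys↭

  contraction-++ : ∀ ws → Contraction r xs ys → Contraction r (ws ++ xs) (ws ++ ys)
  contraction-++ ws (zs , xs↭ , ys↭) = ws ++ zs , shift²-↭ ws xs↭ , shift-↭ ws ys↭

  contraction-map : ∀ {b} {B : Set b} (f : A → B) →
                    Contraction r xs ys → Contraction (f r) (map f xs) (map f ys)
  contraction-map f (zs , xs↭ , ys↭) = map f zs , map⁺ f xs↭ , map⁺ f ys↭

  contraction-dup : xs ↭ r ∷ ys → Contraction r (r ∷ xs) (r ∷ ys)
  contraction-dup p = _ , prep _ p , ↭-refl

  contraction-⊆ : Contraction r xs ys → ys ⊆ xs
  contraction-⊆ (_ , xs↭ , ys↭) =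
    ⊆-trans (⊆-reflexive-↭ ys↭) (⊆-trans (xs⊆x∷xs _ _) (⊆-reflexive-↭ (↭-sym xs↭)))

  contraction-∷-inv : Contraction r (x ∷ xs) ys →
                      (x ≡ r × ∃[ zs ] (xs ↭ r ∷ zs × ys ↭ r ∷ zs)) ⊎
                      ∃[ ys₀ ] (Contraction r xs ys₀ × ys ↭ x ∷ ys₀)
  contraction-∷-inv (zs , xxs↭ , ys↭) with ∷↭∷∷-inv xxs↭
  ... | inj₁ (refl , xs↭)        = inj₁ (refl , zs , xs↭ , ys↭)
  ... | inj₂ (zs₀ , xs↭ , zs↭) =
    inj₂ (_ ∷ zs₀ , (zs₀ , xs↭ , ↭-refl) , ↭-trans ys↭ (shift-↭ [ _ ] zs↭))

  contraction-∷ : Contraction r (x ∷ xs) ys → ∃[ ys₀ ] ys ↭ x ∷ ys₀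
  contraction-∷ (_ , xxs↭ , ys↭) with ys₀ , ↭xys₀ ← ∷↭∷∷⇒∷↭∷ xxs↭ = ys₀ , ↭-trans ys↭ ↭xys₀

  contraction-∷∷-inv : Contraction r (x ∷ x' ∷ xs) ys →
                       (x ≡ r × x' ≡ r) ⊎ ∃[ ys₀ ] ys ↭ x ∷ x' ∷ ys₀
  contraction-∷∷-inv (_ , xxs↭ , ys↭) with ∷∷↭∷∷-inv xxs↭
  ... | inj₁ x≡r,x'≡r        = inj₁ x≡r,x'≡r
  ... | inj₂ (ys₀ , ↭xx'ys₀) = inj₂ (ys₀ , ↭-trans ys↭ ↭xx'ys₀)

Fresh-⊆ : ∀ {w Γ₁ Γ₂ Δ} → Γ₂ ⊆ Γ₁ → Fresh w (Γ₁ ⊢ Δ) → Fresh w (Γ₂ ⊢ Δ)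
Fresh-⊆ sub (w-var , w∉Γ₁ , w∉Δ) = w-var , w∉Γ₁ ∘ Any-resp-⊆ sub , w∉Δ

sL-self : ∀ y x → sL y x x ≡ y
sL-self y x with x ≟L x
... | yes _   = refl
... | no x≢x  = ⊥-elim (x≢x refl)

sL-target : ∀ y x → sL y x y ≡ y
sL-target y x with y ≟L x
... | yes _ = refl
... | no _  = refl

sL-ε : ∀ y x → x ≢ ε → sL y x ε ≡ ε
sL-ε y x x≢ε with ε ≟L x
... | yes ε≡x = ⊥-elim (x≢ε (sym ε≡x))
... | no _    = refl

Eq₁-atom-[/] : ∀ w w' → w ≢ ε → sItem w' w (rel ε w w') ≡ rel ε w' w'
Eq₁-atom-[/] w w' w≢ε rewrite sL-ε w' w w≢ε | sL-self w' w | sL-target w' w = refl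

Eq₂-atom-[/] : ∀ w w' → w ≢ ε → sItem w' w (rel ε w' w) ≡ rel ε w' w'
Eq₂-atom-[/] w w' w≢ε rewrite sL-ε w' w w≢ε | sL-self w' w | sL-target w' w = refl

↭-[/] : ∀ {Γ Γ₀ a b y x} → Γ ↭ a ∷ Γ₀ → sItem y x a ≡ b →
        Γ [ y / x ]ᴳ ↭ b ∷ Γ₀ [ y / x ]ᴳ
↭-[/] p refl = map⁺ _ p

lf∷-contraction-inv : ∀ {w F G Γ x y z} → Contraction (rel x y z) (lf w F ∷ G) Γ →
                      ∃[ Γ₀ ] (Contraction (rel x y z) G Γ₀ × Γ ↭ lf w F ∷ Γ₀)
lf∷-contraction-inv c with contraction-∷-inv c
... | inj₁ (() , _)
... | inj₂ split = split

CutFreeDeriv≤ : ℕ → Seq → Set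
CutFreeDeriv≤ n s = Σ (Deriv s) (λ Π → CutFree Π × height Π ≤ n)

contract : ∀ {Γ' Γ'' Δ x y z} (Π : Deriv (Γ' ⊢ Δ)) → CutFree Π →
           Contraction (rel x y z) Γ' Γ'' → CutFreeDeriv≤ (height Π) (Γ'' ⊢ Δ)
contract (id (γ , δ)) _ c
  with _ , _ , h ← lf∷-contraction-inv (contraction-respˡ γ c) =
  id (h , δ) , _ , s≤s z≤n
contract (⊥L (γ , δ)) _ c
  with _ , _ , h ← lf∷-contraction-inv (contraction-respˡ γ c) =
  ⊥L (h , δ) , _ , s≤s z≤n
contract (⊤R (_ , δ)) _ _ = ⊤R (↭-refl , δ) , _ , s≤s z≤n
contract (⊤*R (_ , δ)) _ _ = ⊤*R (↭-refl , δ) , _ , s≤s z≤n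
contract (cut _ _ _) ()
contract (⊤*L w≢ε (γ , δ) p) cp c
  with _ , d , h ← lf∷-contraction-inv (contraction-respˡ γ c)
  with p' , cp' , hp ← contract p cp (contraction-map _ d) =
  ⊤*L w≢ε (h , δ) p' , cp' , s≤s hp
contract (∧L {w = w} {A = F} {B = G} (γ , δ) p) cp c
  with _ , d , h ← lf∷-contraction-inv (contraction-respˡ γ c)
  with p' , cp' , hp ← contract p cp (contraction-++ (lf w F ∷ lf w G ∷ []) d) =
  ∧L (h , δ) p' , cp' , s≤s hp
contract (⇒L {w = w} {B = G} (γ , δ) p q) (cp , cq) c
  with _ , d , h ← lf∷-contraction-inv (contraction-respˡ γ c)
  with p' , cp' , hp ← contract p cp d
  with q' , cq' , hq ← contract q cq (contraction-++ [ lf w G ] d) =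
  ⇒L (h , δ) p' q' , (cp' , cq') , s≤s (⊔-mono-≤ hp hq)
contract (✱L {x = u} {y = v} {z = w} {A = F} {B = G} (γ , δ) u≢v u-fresh v-fresh p) cp c
  with _ , d , h ← lf∷-contraction-inv (contraction-respˡ γ c)
  with p' , cp' , hp ← contract p cp (contraction-++ (rel u v w ∷ lf u F ∷ lf v G ∷ []) d) =
  let sub = contraction-⊆ (contraction-++ [ _ ] d) in
  ✱L (h , δ) u≢v (Fresh-⊆ sub u-fresh) (Fresh-⊆ sub v-fresh) p' , cp' , s≤s hp
contract (∧R (γ , δ) p q) (cp , cq) c
  with p' , cp' , hp ← contract p cp (contraction-respˡ γ c)
  with q' , cq' , hq ← contract q cq (contraction-respˡ γ c) =
  ∧R (↭-refl , δ) p' q' , (cp' , cq') , s≤s (⊔-mono-≤ hp hq)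
contract (⇒R {w = w} {A = F} (γ , δ) p) cp c
  with p' , cp' , hp ← contract p cp (contraction-++ [ lf w F ] (contraction-respˡ γ c)) =
  ⇒R (↭-refl , δ) p' , cp' , s≤s hp
contract (−✱R {x = u} {y = v} {z = w} {A = F} (γ , δ) u≢w u-fresh w-fresh p) cp c
  with σ ← contraction-respˡ γ c
  with p' , cp' , hp ← contract p cp (contraction-++ (rel u v w ∷ lf u F ∷ []) σ) =
  let sub = contraction-⊆ σ in
  −✱R (↭-refl , δ) u≢w (Fresh-⊆ sub u-fresh) (Fresh-⊆ sub w-fresh) p' , cp' , s≤s hp
contract (✱R (γ , δ) p q) (cp , cq) c
  with σ ← contraction-respˡ γ c
  with _ , h ← contraction-∷ σ
  with p' , cp' , hp ← contract p cp (contraction-respʳ h σ)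
  with q' , cq' , hq ← contract q cq (contraction-respʳ h σ) =
  ✱R (h , δ) p' q' , (cp' , cq') , s≤s (⊔-mono-≤ hp hq)
contract (−✱L {z = w} {B = G} (γ , δ) p q) (cp , cq) c
  with σ ← contraction-respˡ γ c
  with contraction-∷∷-inv σ
... | inj₁ (_ , ())
... | inj₂ (_ , h)
  with p' , cp' , hp ← contract p cp (contraction-respʳ h σ)
  with q' , cq' , hq ← contract q cq
         (contraction-respˡ (↭-sym (shift _ (_ ∷ _ ∷ []) _))
           (contraction-respʳ (↭-sym (shift _ (_ ∷ _ ∷ []) _))
             (contraction-++ [ lf w G ] (contraction-respʳ h σ)))) =
  −✱L (h , δ) p' q' , (cp' , cq') , s≤s (⊔-mono-≤ hp hq)
contract (E {x = u} {y = v} {z = w} (γ , δ) p) cp c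
  with σ ← contraction-respˡ γ c
  with _ , h ← contraction-∷ σ
  with p' , cp' , hp ← contract p cp (contraction-++ [ rel v u w ] (contraction-respʳ h σ)) =
  E (h , δ) p' , cp' , s≤s hp
contract (U {x = u} (γ , δ) p) cp c
  with p' , cp' , hp ← contract p cp (contraction-++ [ rel u ε u ] (contraction-respˡ γ c)) =
  U (↭-refl , δ) p' , cp' , s≤s hp
contract (AC {x = u} {y = v} {w = w} (γ , δ) w-fresh p) cp c
  with σ ← contraction-respˡ γ c
  with _ , h ← contraction-∷ σ
  with p' , cp' , hp ← contract p cp
                          (contraction-++ (rel u w u ∷ rel v v w ∷ []) (contraction-respʳ h σ)) =
  AC (h , δ) (Fresh-⊆ (contraction-⊆ (contraction-respʳ h σ)) w-fresh) p' , cp' , s≤s hp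
contract (A {y = y₁} {z = z₁} {u = u} {v = v} {w = w} (γ , δ) w-fresh p) cp c
  with σ ← contraction-respˡ γ c
  with contraction-∷∷-inv σ
... | inj₂ (_ , h)
  with p' , cp' , hp ← contract p cp
                          (contraction-++ (rel u w z₁ ∷ rel y₁ v w ∷ []) (contraction-respʳ h σ)) =
  A (h , δ) (Fresh-⊆ (contraction-⊆ (contraction-respʳ h σ)) w-fresh) p' , cp' , s≤s hp
... | inj₁ (refl , refl)
  with _ , h ← contraction-∷ σ
  with p' , cp' , hp ← contract p cp
                          (contraction-++ (rel u w z₁ ∷ rel y₁ v w ∷ []) (contraction-respʳ h σ)) =
  AC (h , δ) (Fresh-⊆ (contraction-⊆ (contraction-respʳ h σ)) w-fresh) p' , cp' , s≤s hp
contract (Eq₁ {w = w} {w'} w≢ε (γ , δ) p) cp c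
  with contraction-∷-inv (contraction-respˡ γ c)
... | inj₁ (refl , _ , g , h)
  with p' , cp' , hp ← contract p cp (contraction-dup (↭-[/] g (Eq₁-atom-[/] w w' w≢ε))) =
  Eq₁ w≢ε (h , δ) p' , cp' , s≤s hp
... | inj₂ (_ , d , h)
  with p' , cp' , hp ← contract p cp (contraction-++ [ rel ε w' w' ] (contraction-map _ d)) =
  Eq₁ w≢ε (h , δ) p' , cp' , s≤s hp
contract (Eq₂ {w = w} {w'} w≢ε (γ , δ) p) cp c
  with contraction-∷-inv (contraction-respˡ γ c)
... | inj₁ (refl , _ , g , h)
  with p' , cp' , hp ← contract p cp (contraction-dup (↭-[/] g (Eq₂-atom-[/] w w' w≢ε))) =
  Eq₂ w≢ε (h , δ) p' , cp' , s≤s hp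
... | inj₂ (_ , d , h)
  with p' , cp' , hp ← contract p cp (contraction-++ [ rel ε w' w' ] (contraction-map _ d)) =
  Eq₂ w≢ε (h , δ) p' , cp' , s≤s hp

lemma4 : (Γ : List Item) (Δ : List LF) (x y z : Label)
         (Π : Deriv (rel x y z ∷ rel x y z ∷ Γ ⊢ Δ)) → CutFree Π →
         Σ (Deriv (rel x y z ∷ Γ ⊢ Δ)) (λ Π' → CutFree Π' × height Π' ≤ height Π)
lemma4 Γ Δ x y z Π cutFree = contract Π cutFree (Γ , ↭-refl , ↭-refl)
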